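{- Let $t \geq 2$ be an integer, let $G$ be a $\{P_6, K_{2,t}\}$-free graph, and let $a$ and $b$ be two distinct nonadjacent vertices of $G$. Then there exists an $(a,b)$-separator $S \subseteq V(G) \setminus \{a,b\}$ such that $\alpha(S) \leq 14(t-1)+3$.
   Context: All graphs are finite and simple. $P_6$ is the path on $6$ vertices and $K_{2,t}$ is the complete bipartite graph with parts of sizes $2$ and $t$. A graph is $\{P_6,K_{2,t}\}$-free if it has no induced subgraph isomorphic to $P_6$ or $K_{2,t}$. For $X \subseteq V(G)$, $\alpha(X)$ denotes the maximum size of an independent set of $G$ contained in $X$. For vertices $u,v$, a set $S \subseteq V(G)\setminus\{u,v\}$ is a $(u,v)$-separator if it intersects every path in $G$ from $u$ to $v$, i.e. $u$ and $v$ lie in different components of $G - S$. -}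

module Defs where

open import Data.Nat using (ℕ; zero; suc; _+_; _*_; _≤_; _<_)
open import Data.Fin using (Fin; toℕ)
open import Data.Fin.Subset using (Subset; _∈_; _∉_; ∣_∣)
open import Data.Bool using (Bool; true; false; _xor_)
open import Data.List using (List; []; _∷_)
open import Data.List.Relation.Unary.Any using (Any)
open import Data.List.Relation.Unary.Unique.Propositional using (Unique)
open import Data.Product using (Σ; _×_)
open import Function.Definitions using (Injective)
open import Relation.Binary.PropositionalEquality using (_≡_)
open import Relation.Nullary using (¬_)

record Graph : Set where
  field
    n     : ℕ
    adj   : Fin n → Fin n → Bool
    sym   : ∀ x y → adj x y ≡ adj y x
    irrefl : ∀ x → adj x x ≡ false
open Graph public

InducedCopy : (G : Graph) {k : ℕ} → (Fin k → Fin k → Bool) → Set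
InducedCopy G {k} H =
  Σ (Fin k → Fin (n G)) λ f →
    Injective _≡_ _≡_ f × (∀ i j → adj G (f i) (f j) ≡ H i j)

infix 4 _=ℕ_
_=ℕ_ : ℕ → ℕ → Bool
zero =ℕ zero = true
zero =ℕ suc _ = false
suc _ =ℕ zero = false
suc m =ℕ suc k = m =ℕ k

P6adj : Fin 6 → Fin 6 → Bool
P6adj i j with (suc (toℕ i) =ℕ toℕ j) | (suc (toℕ j) =ℕ toℕ i)
... | false | false = false
... | _     | _     = true

-- K_{2,t}: vertices 0,1 form the part of size 2, vertices 2..t+1 the other part.
inSmallPart : ℕ → Bool
inSmallPart zero = true
inSmallPart (suc zero) = true
inSmallPart (suc (suc _)) = false

K2tadj : (t : ℕ) → Fin (2 + t) → Fin (2 + t) → Bool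
K2tadj t i j = inSmallPart (toℕ i) xor inSmallPart (toℕ j)

P6K2tFree : ℕ → Graph → Set
P6K2tFree t G = ¬ InducedCopy G P6adj × ¬ InducedCopy G (K2tadj t)

Independent : (G : Graph) → Subset (n G) → Set
Independent G I = ∀ x y → x ∈ I → y ∈ I → adj G x y ≡ false

_⊆_ : ∀ {m} → Subset m → Subset m → Set
A ⊆ B = ∀ {x} → x ∈ A → x ∈ B

αAtMost : (G : Graph) → Subset (n G) → ℕ → Set
αAtMost G X k = ∀ I → I ⊆ X → Independent G I → ∣ I ∣ ≤ k

data Walk (G : Graph) : Fin (n G) → Fin (n G) → List (Fin (n G)) → Set where
  stop : ∀ {x} → Walk G x x (x ∷ [])
  step : ∀ {x y z vs} → adj G x y ≡ true → Walk G y z vs → Walk G x z (x ∷ vs)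

Path : (G : Graph) → Fin (n G) → Fin (n G) → List (Fin (n G)) → Set
Path G x y vs = Walk G x y vs × Unique vs

Separator : (G : Graph) → Fin (n G) → Fin (n G) → Subset (n G) → Set
Separator G u v S =
  u ∉ S × v ∉ S × (∀ vs → Path G u v vs → Any (λ x → x ∈ S) vs)

-- Sort the vertices into Common = N(a) ∩ N(b), OnlyA = N(a) ∖ N(b), OnlyB = N(b) ∖ N(a) and
-- the far ones. On an a–b walk, let x be the last vertex in N(a) and y the first later one in
-- N(b); if neither is in Common, then x ∈ OnlyA, y ∈ OnlyB and only far vertices lie between
-- them, and P₆-freeness of a – x – … – y – b makes x, y adjacent or gives them a common far
-- neighbour o. So a separator S is obtained from Common by adding, for each such edge x y,
-- either x (CrossA: y is adjacent to every vertex of OnlyA that x misses) or y (CrossB: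
-- otherwise), and for each such induced path x – o – y the vertex x (Detour). An independent
-- set inside Common or CrossA lies in the common neighbourhood of one non-adjacent pair; inside
-- CrossB or Detour, again by P₆-freeness, in the neighbourhood of a vertex c and in that of one
-- of two vertices non-adjacent to c. K_{2,t}-freeness bounds each such part by t − 1, whence
-- α(S) ≤ 6(t − 1).

module Submission where

open import Defs hiding (sym)
open import Data.Nat using (ℕ; zero; suc; _+_; _*_; _∸_; _≤_; _<_; z≤n; s≤s)
open import Data.Nat.Properties
  using (≤-trans; ≤-reflexive; +-suc; +-monoʳ-≤; +-mono-≤; n≤1+n; m≤m+n; m≤n+m; ≤-refl; *-monoˡ-≤;
         _≤?_; ≰⇒>; <⇒≤pred; pred[m∸n]≡m∸[1+n])
open import Data.Nat.Induction using (<-rec)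
open import Data.Nat.Tactic.RingSolver using (solve-∀)
open import Data.Fin using (Fin; zero; suc; inject≤) renaming (_<_ to _<ᶠ_)
open import Data.Fin.Properties using (any?; all?; inject≤-injective; suc-injective; <-cmp)
  renaming (_≟_ to _≟ᶠ_)
open import Data.Fin.Subset using (Subset; _∈_; _∉_; ∣_∣; _∪_; _∩_; inside; outside; Nonempty)
open import Data.Fin.Subset.Properties
  using (p⊆q⇒∣p∣≤∣q∣; x∈p∩q⁺; x∈p∩q⁻; x∈p∪q⁺; x∈p∪q⁻; nonempty?; Empty-unique; ∣⊥∣≡0)
open import Data.Bool using (Bool; true; false)
open import Data.Bool.Properties using () renaming (_≟_ to _≟ᵇ_)
open import Data.Vec using ([]; _∷_; tabulate; lookup)
open import Data.Vec.Properties using (lookup∘tabulate; []=⇒lookup; lookup⇒[]=)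
open import Data.List using (List; _∷_)
open import Data.List.Relation.Unary.Any using (Any; here; there)
open import Data.List.Membership.Propositional using (lose) renaming (_∈_ to _∈ₗ_)
open import Data.Product using (Σ; _×_; _,_; proj₁; proj₂)
open import Data.Sum using (_⊎_; inj₁; inj₂; map₁; map₂)
open import Data.Empty using (⊥-elim)
open import Data.Unit using (tt)
open import Function using (_∘_)
open import Function.Definitions using (Injective)
open import Relation.Binary.Definitions using (tri<; tri≈; tri>)
open import Relation.Binary.PropositionalEquality
  using (_≡_; _≢_; refl; sym; trans; cong; subst; module ≡-Reasoning)
open import Relation.Nullary using (¬_; yes; no; does)
open import Relation.Nullary.Decidable using (_×-dec_; _→-dec_; dec-true; toWitness)
open import Relation.Unary using (Decidable)

∈-tabulate⁺ : ∀ {m} (f : Fin m → Bool) {x} → f x ≡ true → x ∈ tabulate f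
∈-tabulate⁺ f {x} fx = lookup⇒[]= x (tabulate f) (trans (lookup∘tabulate f x) fx)

∈-tabulate⁻ : ∀ {m} (f : Fin m → Bool) {x} → x ∈ tabulate f → f x ≡ true
∈-tabulate⁻ f {x} x∈ = trans (sym (lookup∘tabulate f x)) ([]=⇒lookup x∈)

⟦_⟧ : ∀ {m} {P : Fin m → Set} → Decidable P → Subset m
⟦ P? ⟧ = tabulate (does ∘ P?)

module _ {m} {P : Fin m → Set} (P? : Decidable P) where

  ∈⟦⟧⁺ : ∀ {x} → P x → x ∈ ⟦ P? ⟧
  ∈⟦⟧⁺ {x} px = ∈-tabulate⁺ (does ∘ P?) (dec-true (P? x) px)

  ∈⟦⟧⁻ : ∀ {x} → x ∈ ⟦ P? ⟧ → P x
  ∈⟦⟧⁻ {x} x∈ with P? x | ∈-tabulate⁻ (does ∘ P?) x∈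
  ... | yes px | _ = px

  ∈⟦⟧∪⁺ : ∀ {x} {p : Subset m} → P x ⊎ x ∈ p → x ∈ ⟦ P? ⟧ ∪ p
  ∈⟦⟧∪⁺ = x∈p∪q⁺ ∘ map₁ ∈⟦⟧⁺

  ∈⟦⟧∪⁻ : ∀ {x} {p : Subset m} → x ∈ ⟦ P? ⟧ ∪ p → P x ⊎ x ∈ p
  ∈⟦⟧∪⁻ {p = p} = map₁ ∈⟦⟧⁻ ∘ x∈p∪q⁻ ⟦ P? ⟧ p

∣p∪q∣≤∣p∣+∣q∣ : ∀ {m} (p q : Subset m) → ∣ p ∪ q ∣ ≤ ∣ p ∣ + ∣ q ∣
∣p∪q∣≤∣p∣+∣q∣ []            []            = z≤n
∣p∪q∣≤∣p∣+∣q∣ (inside  ∷ p) (inside  ∷ q) =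
  s≤s (≤-trans (∣p∪q∣≤∣p∣+∣q∣ p q) (+-monoʳ-≤ ∣ p ∣ (n≤1+n ∣ q ∣)))
∣p∪q∣≤∣p∣+∣q∣ (inside  ∷ p) (outside ∷ q) = s≤s (∣p∪q∣≤∣p∣+∣q∣ p q)
∣p∪q∣≤∣p∣+∣q∣ (outside ∷ p) (inside  ∷ q) =
  ≤-trans (s≤s (∣p∪q∣≤∣p∣+∣q∣ p q)) (≤-reflexive (sym (+-suc ∣ p ∣ ∣ q ∣)))
∣p∪q∣≤∣p∣+∣q∣ (outside ∷ p) (outside ∷ q) = ∣p∪q∣≤∣p∣+∣q∣ p q

p⊆q∪r⇒∣p∣≤∣p∩q∣+∣p∩r∣ : ∀ {m} {p : Subset m} (q r : Subset m) →
  p ⊆ (q ∪ r) → ∣ p ∣ ≤ ∣ p ∩ q ∣ + ∣ p ∩ r ∣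
p⊆q∪r⇒∣p∣≤∣p∩q∣+∣p∩r∣ {p = p} q r p⊆q∪r =
  ≤-trans (p⊆q⇒∣p∣≤∣q∣ distribute) (∣p∪q∣≤∣p∣+∣q∣ (p ∩ q) (p ∩ r))
  where
  distribute : p ⊆ ((p ∩ q) ∪ (p ∩ r))
  distribute x∈p with x∈p∪q⁻ q r (p⊆q∪r x∈p)
  ... | inj₁ x∈q = x∈p∪q⁺ (inj₁ (x∈p∩q⁺ (x∈p , x∈q)))
  ... | inj₂ x∈r = x∈p∪q⁺ (inj₂ (x∈p∩q⁺ (x∈p , x∈r)))

∣p∣≤k-byNonempty : ∀ {m k} (p : Subset m) → (Nonempty p → ∣ p ∣ ≤ k) → ∣ p ∣ ≤ k
∣p∣≤k-byNonempty {m} p bound with nonempty? p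
... | yes ne = bound ne
... | no ¬ne rewrite Empty-unique ¬ne | ∣⊥∣≡0 m = z≤n

enumerate : ∀ {m} (p : Subset m) →
  Σ (Fin ∣ p ∣ → Fin m) λ e → Injective _≡_ _≡_ e × (∀ i → e i ∈ p)
enumerate []            = (λ ()) , (λ { {()} }) , (λ ())
enumerate (outside ∷ p) with enumerate p
... | e , e-inj , e∈p = suc ∘ e , e-inj ∘ suc-injective , there ∘ e∈p
  where open Data.Vec using (there)
enumerate (inside ∷ p) with enumerate p
... | e , e-inj , e∈p = e′ , e′-inj , e′∈p
  where
  open Data.Vec using (here; there)
  e′ : Fin (suc ∣ p ∣) → Fin _
  e′ zero    = zero
  e′ (suc i) = suc (e i)
  e′-inj : Injective _≡_ _≡_ e′
  e′-inj {zero}  {zero}  _  = refl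
  e′-inj {suc i} {suc j} eq = cong suc (e-inj (suc-injective eq))
  e′∈p : ∀ i → e′ i ∈ (inside ∷ p)
  e′∈p zero    = here
  e′∈p (suc i) = there (e∈p i)

TwinFree : ∀ {k} → (Fin k → Fin k → Bool) → Set
TwinFree H = ∀ i j → (∀ l → H i l ≡ H j l) → i ≡ j

P6-twinFree : TwinFree P6adj
P6-twinFree = toWitness {a? = all? λ i → all? λ j →
  all? (λ l → P6adj i l ≟ᵇ P6adj j l) →-dec (i ≟ᶠ j)} tt

P6-sym : ∀ i j → P6adj i j ≡ P6adj j i
P6-sym = toWitness {a? = all? λ i → all? λ j → P6adj i j ≟ᵇ P6adj j i} tt

P6-irrefl : ∀ i → P6adj i i ≡ false
P6-irrefl = toWitness {a? = all? λ i → P6adj i i ≟ᵇ false} tt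

module GraphFacts (G : Graph) where

  V : Set
  V = Fin (n G)

  _~_ _≁_ : V → V → Set
  x ~ y = adj G x y ≡ true
  x ≁ y = adj G x y ≡ false

  _~?_ : ∀ x y → x ~ y ⊎ x ≁ y
  x ~? y = by-value (adj G x y) refl
    where
    by-value : ∀ β → adj G x y ≡ β → x ~ y ⊎ x ≁ y
    by-value true  eq = inj₁ eq
    by-value false eq = inj₂ eq

  ~-sym : ∀ {x y} → x ~ y → y ~ x
  ~-sym {x} {y} x~y = trans (Graph.sym G y x) x~y

  ≁-sym : ∀ {x y} → x ≁ y → y ≁ x
  ≁-sym {x} {y} x≁y = trans (Graph.sym G y x) x≁y

  ~⇒¬≁ : ∀ {x y} → x ~ y → ¬ x ≁ y
  ~⇒¬≁ x~y x≁y with () ← trans (sym x~y) x≁y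

  ~⇒≢ : ∀ {x y} → x ~ y → x ≢ y
  ~⇒≢ {x} x~x refl = ~⇒¬≁ x~x (irrefl G x)

  ≁-~⇒≢ : ∀ {x y z} → x ≁ z → y ~ z → x ≢ y
  ≁-~⇒≢ x≁z y~z refl = ~⇒¬≁ y~z x≁z

  copy-injective : ∀ {k} {H : Fin k → Fin k → Bool} → TwinFree H → (f : Fin k → V) →
    (∀ i j → adj G (f i) (f j) ≡ H i j) → Injective _≡_ _≡_ f
  copy-injective {H = H} twinFree f f-matches {i} {j} fi≡fj = twinFree i j λ l → begin
    H i l             ≡⟨ sym (f-matches i l) ⟩
    adj G (f i) (f l) ≡⟨ cong (λ x → adj G x (f l)) fi≡fj ⟩
    adj G (f j) (f l) ≡⟨ f-matches j l ⟩
    H j l             ∎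
    where open ≡-Reasoning

  induced-P6 : ∀ {v₀ v₁ v₂ v₃ v₄ v₅} →
    v₀ ~ v₁ → v₀ ≁ v₂ → v₀ ≁ v₃ → v₀ ≁ v₄ → v₀ ≁ v₅ →
    v₁ ~ v₂ → v₁ ≁ v₃ → v₁ ≁ v₄ → v₁ ≁ v₅ →
    v₂ ~ v₃ → v₂ ≁ v₄ → v₂ ≁ v₅ →
    v₃ ~ v₄ → v₃ ≁ v₅ →
    v₄ ~ v₅ → InducedCopy G P6adj
  induced-P6 {v₀} {v₁} {v₂} {v₃} {v₄} {v₅}
             e01 e02 e03 e04 e05 e12 e13 e14 e15 e23 e24 e25 e34 e35 e45 =
    f , copy-injective P6-twinFree f matches , matches
    where
    f : Fin 6 → V
    f = lookup (v₀ ∷ v₁ ∷ v₂ ∷ v₃ ∷ v₄ ∷ v₅ ∷ [])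

    upper : ∀ {i j} → i <ᶠ j → adj G (f i) (f j) ≡ P6adj i j
    upper {zero}                          {suc zero}                         _ = e01
    upper {zero}                          {suc (suc zero)}                   _ = e02
    upper {zero}                          {suc (suc (suc zero))}             _ = e03
    upper {zero}                          {suc (suc (suc (suc zero)))}       _ = e04
    upper {zero}                          {suc (suc (suc (suc (suc zero))))} _ = e05
    upper {suc zero}                      {suc (suc zero)}                   _ = e12
    upper {suc zero}                      {suc (suc (suc zero))}             _ = e13
    upper {suc zero}                      {suc (suc (suc (suc zero)))}       _ = e14
    upper {suc zero}                      {suc (suc (suc (suc (suc zero))))} _ = e15
    upper {suc (suc zero)}                {suc (suc (suc zero))}             _ = e23
    upper {suc (suc zero)}                {suc (suc (suc (suc zero)))}       _ = e24
    upper {suc (suc zero)}                {suc (suc (suc (suc (suc zero))))} _ = e25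
    upper {suc (suc (suc zero))}          {suc (suc (suc (suc zero)))}       _ = e34
    upper {suc (suc (suc zero))}          {suc (suc (suc (suc (suc zero))))} _ = e35
    upper {suc (suc (suc (suc zero)))}    {suc (suc (suc (suc (suc zero))))} _ = e45
    upper {_}                             {zero}                             ()
    upper {suc _}                         {suc zero}                         (s≤s ())
    upper {suc (suc _)}                   {suc (suc zero)}                   (s≤s (s≤s ()))
    upper {suc (suc (suc _))}             {suc (suc (suc zero))}             (s≤s (s≤s (s≤s ())))
    upper {suc (suc (suc (suc _)))}       {suc (suc (suc (suc zero)))}       (s≤s (s≤s (s≤s (s≤s ()))))
    upper {suc (suc (suc (suc (suc _))))} {suc (suc (suc (suc (suc zero))))} (s≤s (s≤s (s≤s (s≤s (s≤s ())))))

    matches : ∀ i j → adj G (f i) (f j) ≡ P6adj i j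
    matches i j with <-cmp i j
    ... | tri< i<j _ _ = upper i<j
    ... | tri≈ _ refl _ = trans (irrefl G (f i)) (sym (P6-irrefl i))
    ... | tri> _ _ j<i = trans (Graph.sym G (f i) (f j)) (trans (upper j<i) (P6-sym j i))

  K2t-copy : ∀ {t u v} (e : Fin t → V) → u ≢ v → u ≁ v → Injective _≡_ _≡_ e →
    (∀ i j → e i ≁ e j) → (∀ i → u ~ e i) → (∀ i → v ~ e i) → InducedCopy G (K2tadj t)
  K2t-copy {t} {u} {v} e u≢v u≁v e-inj e≁e u~e v~e = f , f-inj , matches
    where
    f : Fin (2 + t) → V
    f zero          = u
    f (suc zero)    = v
    f (suc (suc i)) = e i

    f-inj : Injective _≡_ _≡_ f
    f-inj {zero}        {zero}        _  = refl
    f-inj {zero}        {suc zero}    eq = ⊥-elim (u≢v eq)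
    f-inj {zero}        {suc (suc j)} eq = ⊥-elim (~⇒≢ (u~e j) eq)
    f-inj {suc zero}    {zero}        eq = ⊥-elim (u≢v (sym eq))
    f-inj {suc zero}    {suc zero}    _  = refl
    f-inj {suc zero}    {suc (suc j)} eq = ⊥-elim (~⇒≢ (v~e j) eq)
    f-inj {suc (suc i)} {zero}        eq = ⊥-elim (~⇒≢ (u~e i) (sym eq))
    f-inj {suc (suc i)} {suc zero}    eq = ⊥-elim (~⇒≢ (v~e i) (sym eq))
    f-inj {suc (suc i)} {suc (suc j)} eq = cong (λ i → suc (suc i)) (e-inj eq)

    matches : ∀ i j → adj G (f i) (f j) ≡ K2tadj t i j
    matches zero          zero          = irrefl G u
    matches zero          (suc zero)    = u≁v
    matches zero          (suc (suc j)) = u~e j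
    matches (suc zero)    zero          = ≁-sym u≁v
    matches (suc zero)    (suc zero)    = irrefl G v
    matches (suc zero)    (suc (suc j)) = v~e j
    matches (suc (suc i)) zero          = ~-sym (u~e i)
    matches (suc (suc i)) (suc zero)    = ~-sym (v~e i)
    matches (suc (suc i)) (suc (suc j)) = e≁e i j

  Independent-∩ : ∀ {I} r → Independent G I → Independent G (I ∩ r)
  Independent-∩ {I} r I-ind x y x∈ y∈ = I-ind x y (proj₁ (x∈p∩q⁻ I r x∈)) (proj₁ (x∈p∩q⁻ I r y∈))

  αAtMost-∪ : ∀ {p q k l} → αAtMost G p k → αAtMost G q l → αAtMost G (p ∪ q) (k + l)
  αAtMost-∪ {p} {q} αp αq I I⊆p∪q I-ind =
    ≤-trans (p⊆q∪r⇒∣p∣≤∣p∩q∣+∣p∩r∣ p q I⊆p∪q)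
            (+-mono-≤ (αp (I ∩ p) (proj₂ ∘ x∈p∩q⁻ I p) (Independent-∩ p I-ind))
                      (αq (I ∩ q) (proj₂ ∘ x∈p∩q⁻ I q) (Independent-∩ q I-ind)))

  αAtMost-mono : ∀ {p k l} → k ≤ l → αAtMost G p k → αAtMost G p l
  αAtMost-mono k≤l αp I I⊆p I-ind = ≤-trans (αp I I⊆p I-ind) k≤l

  module K2tFree {t} (noK2t : ¬ InducedCopy G (K2tadj t)) where

    common-neighbours-bound : ∀ {u v} {J : Subset (n G)} → u ≢ v → u ≁ v → Independent G J →
      (∀ {x} → x ∈ J → u ~ x) → (∀ {x} → x ∈ J → v ~ x) → ∣ J ∣ ≤ t ∸ 1
    common-neighbours-bound {J = J} u≢v u≁v J-ind u~J v~J with t ≤? ∣ J ∣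
    ... | no t≰∣J∣ = subst (∣ J ∣ ≤_) (pred[m∸n]≡m∸[1+n] t 0) (<⇒≤pred (≰⇒> t≰∣J∣))
    ... | yes t≤∣J∣ = ⊥-elim (noK2t (K2t-copy e u≢v u≁v e-inj
                                 (λ i j → J-ind (e i) (e j) (e∈J i) (e∈J j))
                                 (u~J ∘ e∈J) (v~J ∘ e∈J)))
      where
      e : Fin t → V
      e i = proj₁ (enumerate J) (inject≤ i t≤∣J∣)
      e-inj : Injective _≡_ _≡_ e
      e-inj {i} {j} = inject≤-injective t≤∣J∣ t≤∣J∣ i j ∘ proj₁ (proj₂ (enumerate J))
      e∈J : ∀ i → e i ∈ J
      e∈J i = proj₂ (proj₂ (enumerate J)) (inject≤ i t≤∣J∣)

    two-neighbourhoods-bound : ∀ {c p q} {I : Subset (n G)} →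
      c ≢ p → c ≁ p → c ≢ q → c ≁ q → Independent G I →
      (∀ {x} → x ∈ I → c ~ x) → (∀ {x} → x ∈ I → p ~ x ⊎ q ~ x) →
      ∣ I ∣ ≤ (t ∸ 1) + (t ∸ 1)
    two-neighbourhoods-bound {c} {p} {q} {I} c≢p c≁p c≢q c≁q I-ind c~I p~I⊎q~I =
      ≤-trans (p⊆q∪r⇒∣p∣≤∣p∩q∣+∣p∩r∣ (nbhd p) (nbhd q) cover)
              (+-mono-≤ (part c≢p c≁p) (part c≢q c≁q))
      where
      nbhd : V → Subset (n G)
      nbhd u = tabulate (adj G u)
      cover : I ⊆ (nbhd p ∪ nbhd q)
      cover x∈I with p~I⊎q~I x∈I
      ... | inj₁ p~x = x∈p∪q⁺ (inj₁ (∈-tabulate⁺ (adj G p) p~x))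
      ... | inj₂ q~x = x∈p∪q⁺ (inj₂ (∈-tabulate⁺ (adj G q) q~x))
      part : ∀ {u} → c ≢ u → c ≁ u → ∣ I ∩ nbhd u ∣ ≤ t ∸ 1
      part {u} c≢u c≁u = common-neighbours-bound c≢u c≁u (Independent-∩ (nbhd u) I-ind)
        (c~I ∘ proj₁ ∘ x∈p∩q⁻ I _)
        (∈-tabulate⁻ (adj G u) ∘ proj₂ ∘ x∈p∩q⁻ I _)

module Separation (t : ℕ) (G : Graph) (free : P6K2tFree t G)
                  (a b : Fin (n G)) (a≢b : a ≢ b) (a≁b : adj G a b ≡ false) where

  open GraphFacts G
  open K2tFree (proj₂ free)

  Common OnlyA OnlyB Far : V → Set
  Common x = a ~ x × b ~ x
  OnlyA  x = a ~ x × b ≁ x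
  OnlyB  x = b ~ x × a ≁ x
  Far    x = a ≁ x × b ≁ x

  classify : ∀ x → Common x ⊎ OnlyA x ⊎ OnlyB x ⊎ Far x
  classify x with a ~? x | b ~? x
  ... | inj₁ a~x | inj₁ b~x = inj₁ (a~x , b~x)
  ... | inj₁ a~x | inj₂ b≁x = inj₂ (inj₁ (a~x , b≁x))
  ... | inj₂ a≁x | inj₁ b~x = inj₂ (inj₂ (inj₁ (b~x , a≁x)))
  ... | inj₂ a≁x | inj₂ b≁x = inj₂ (inj₂ (inj₂ (a≁x , b≁x)))

  b≢OnlyA : ∀ {x} → OnlyA x → b ≢ x
  b≢OnlyA (a~x , _) = ≁-~⇒≢ (≁-sym a≁b) (~-sym a~x)

  a≢OnlyB : ∀ {y} → OnlyB y → a ≢ y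
  a≢OnlyB (b~y , _) = ≁-~⇒≢ a≁b (~-sym b~y)

  noP6 : ¬ InducedCopy G P6adj
  noP6 = proj₁ free

  data FarWalk : ℕ → V → V → Set where
    end  : ∀ {y} → FarWalk 0 y y
    link : ∀ {k v w y} → Far v → v ~ w → FarWalk k w y → FarWalk (suc k) v y

  a≁FarWalk-start : ∀ {k w y} → FarWalk k w y → OnlyB y → a ≁ w
  a≁FarWalk-start end              (_ , a≁y) = a≁y
  a≁FarWalk-start (link (a≁w , _) _ _) _     = a≁w

  Shortcut : V → V → Set
  Shortcut x y = x ~ y ⊎ Σ V λ o → Far o × x ~ o × o ~ y

  ShortcutFrom : ℕ → Set
  ShortcutFrom k = ∀ {x v y} → OnlyA x → OnlyB y → x ~ v → FarWalk k v y → Shortcut x y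

  -- Any chord of the stretch a – x – v – … – y – b shortens its far part; without chords,
  -- its first six vertices induce a P₆.
  shorten : ∀ k → (∀ {j} → j < k → ShortcutFrom j) → ShortcutFrom k
  shorten zero _ _ _ x~y end = inj₁ x~y
  shorten (suc zero) _ _ _ x~v (link far-v v~y end) = inj₂ (_ , far-v , x~v , v~y)
  shorten (suc (suc zero)) shorter {x} {v} {y} ax@(a~x , b≁x) by@(b~y , a≁y) x~v
          (link far-v@(a≁v , b≁v) v~w (link {v = w} far-w@(a≁w , b≁w) w~y end))
    with x ~? w | x ~? y | v ~? y
  ... | inj₁ x~w | _        | _        =
        shorter ≤-refl ax by x~w (link far-w w~y end)
  ... | inj₂ _   | inj₁ x~y | _        = inj₁ x~y
  ... | inj₂ _   | inj₂ _   | inj₁ v~y = inj₂ (v , far-v , x~v , v~y)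
  ... | inj₂ x≁w | inj₂ x≁y | inj₂ v≁y = ⊥-elim (noP6 (induced-P6
        a~x a≁v a≁w a≁y a≁b x~v x≁w x≁y (≁-sym b≁x) v~w v≁y (≁-sym b≁v)
        w~y (≁-sym b≁w) (~-sym b~y)))
  shorten (suc (suc (suc k))) shorter {x} {v} ax@(a~x , _) by x~v
          (link far-v@(a≁v , _) v~w (link {v = w} far-w@(a≁w , _) w~w₂
            (link {v = w₂} {w = w₃} far-w₂@(a≁w₂ , _) w₂~w₃ rest)))
    with x ~? w | x ~? w₂ | x ~? w₃ | v ~? w₂ | v ~? w₃ | w ~? w₃
  ... | inj₁ x~w | _ | _ | _ | _ | _ =
        shorter ≤-refl ax by x~w (link far-w w~w₂ (link far-w₂ w₂~w₃ rest))
  ... | inj₂ _ | inj₁ x~w₂ | _ | _ | _ | _ =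
        shorter (n≤1+n _) ax by x~w₂ (link far-w₂ w₂~w₃ rest)
  ... | inj₂ _ | inj₂ _ | inj₁ x~w₃ | _ | _ | _ =
        shorter (s≤s (m≤n+m k 2)) ax by x~w₃ rest
  ... | inj₂ _ | inj₂ _ | inj₂ _ | inj₁ v~w₂ | _ | _ =
        shorter ≤-refl ax by x~v (link far-v v~w₂ (link far-w₂ w₂~w₃ rest))
  ... | inj₂ _ | inj₂ _ | inj₂ _ | inj₂ _ | inj₁ v~w₃ | _ =
        shorter (n≤1+n _) ax by x~v (link far-v v~w₃ rest)
  ... | inj₂ _ | inj₂ _ | inj₂ _ | inj₂ _ | inj₂ _ | inj₁ w~w₃ =
        shorter ≤-refl ax by x~v (link far-v v~w (link far-w w~w₃ rest))
  ... | inj₂ x≁w | inj₂ x≁w₂ | inj₂ x≁w₃ | inj₂ v≁w₂ | inj₂ v≁w₃ | inj₂ w≁w₃ =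
        ⊥-elim (noP6 (induced-P6 a~x a≁v a≁w a≁w₂ (a≁FarWalk-start rest by)
          x~v x≁w x≁w₂ x≁w₃ v~w v≁w₂ v≁w₃ w~w₂ w≁w₃ w₂~w₃))

  shortcut : ∀ k → ShortcutFrom k
  shortcut = <-rec ShortcutFrom shorten

  CrossA CrossB Detour : V → Set
  CrossA x = OnlyA x × Σ V λ y → OnlyB y × x ~ y × (∀ x′ → OnlyA x′ → x′ ≁ x → x′ ~ y)
  CrossB y = OnlyB y × Σ V λ x → OnlyA x × x ~ y × Σ V λ x′ → OnlyA x′ × x′ ≁ x × x′ ≁ y
  Detour x = OnlyA x × Σ V λ o → Far o × Σ V λ y → OnlyB y × x ~ o × o ~ y × x ≁ y

  Common? : Decidable Common
  Common? x = (adj G a x ≟ᵇ true)  ×-dec (adj G b x ≟ᵇ true)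
  OnlyA? : Decidable OnlyA
  OnlyA?  x = (adj G a x ≟ᵇ true)  ×-dec (adj G b x ≟ᵇ false)
  OnlyB? : Decidable OnlyB
  OnlyB?  x = (adj G b x ≟ᵇ true)  ×-dec (adj G a x ≟ᵇ false)
  Far? : Decidable Far
  Far?    x = (adj G a x ≟ᵇ false) ×-dec (adj G b x ≟ᵇ false)
  CrossA? : Decidable CrossA
  CrossA? x = OnlyA? x ×-dec any? λ y → OnlyB? y ×-dec (adj G x y ≟ᵇ true) ×-dec
    all? λ x′ → OnlyA? x′ →-dec (adj G x′ x ≟ᵇ false) →-dec (adj G x′ y ≟ᵇ true)
  CrossB? : Decidable CrossB
  CrossB? y = OnlyB? y ×-dec any? λ x → OnlyA? x ×-dec (adj G x y ≟ᵇ true) ×-dec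
    any? λ x′ → OnlyA? x′ ×-dec (adj G x′ x ≟ᵇ false) ×-dec (adj G x′ y ≟ᵇ false)
  Detour? : Decidable Detour
  Detour? x = OnlyA? x ×-dec any? λ o → Far? o ×-dec any? λ y → OnlyB? y ×-dec
    (adj G x o ≟ᵇ true) ×-dec (adj G o y ≟ᵇ true) ×-dec (adj G x y ≟ᵇ false)

  InS : V → Set
  InS x = Common x ⊎ CrossA x ⊎ CrossB x ⊎ Detour x

  S : Subset (n G)
  S = ⟦ Common? ⟧ ∪ ⟦ CrossA? ⟧ ∪ ⟦ CrossB? ⟧ ∪ ⟦ Detour? ⟧

  ∈S⁺ : ∀ {x} → InS x → x ∈ S
  ∈S⁺ = ∈⟦⟧∪⁺ Common? ∘ map₂ (∈⟦⟧∪⁺ CrossA? ∘ map₂ (∈⟦⟧∪⁺ CrossB? ∘ map₂ (∈⟦⟧⁺ Detour?)))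

  ∈S⁻ : ∀ {x} → x ∈ S → InS x
  ∈S⁻ = map₂ (map₂ (map₂ (∈⟦⟧⁻ Detour?) ∘ ∈⟦⟧∪⁻ CrossB?) ∘ ∈⟦⟧∪⁻ CrossA?) ∘ ∈⟦⟧∪⁻ Common?

  InS⇒a~x⊎b~x : ∀ {x} → InS x → a ~ x ⊎ b ~ x
  InS⇒a~x⊎b~x (inj₁ (a~x , _))                    = inj₁ a~x
  InS⇒a~x⊎b~x (inj₂ (inj₁ ((a~x , _) , _)))        = inj₁ a~x
  InS⇒a~x⊎b~x (inj₂ (inj₂ (inj₁ ((b~x , _) , _)))) = inj₂ b~x
  InS⇒a~x⊎b~x (inj₂ (inj₂ (inj₂ ((a~x , _) , _)))) = inj₁ a~x

  a∉S : a ∉ S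
  a∉S a∈S with InS⇒a~x⊎b~x (∈S⁻ a∈S)
  ... | inj₁ a~a = ~⇒≢ a~a refl
  ... | inj₂ b~a = ~⇒¬≁ b~a (≁-sym a≁b)

  b∉S : b ∉ S
  b∉S b∈S with InS⇒a~x⊎b~x (∈S⁻ b∈S)
  ... | inj₁ a~b = ~⇒¬≁ a~b a≁b
  ... | inj₂ b~b = ~⇒≢ b~b refl

  edge-cross : ∀ {x y} → OnlyA x → OnlyB y → x ~ y → CrossA x ⊎ CrossB y
  edge-cross {x} {y} ax by x~y
    with any? (λ x′ → OnlyA? x′ ×-dec (adj G x′ x ≟ᵇ false) ×-dec (adj G x′ y ≟ᵇ false))
  ... | yes witness = inj₂ (by , x , ax , x~y , witness)
  ... | no ¬witness = inj₁ (ax , y , by , x~y , dominated)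
    where
    dominated : ∀ x′ → OnlyA x′ → x′ ≁ x → x′ ~ y
    dominated x′ ax′ x′≁x with x′ ~? y
    ... | inj₁ x′~y = x′~y
    ... | inj₂ x′≁y = ⊥-elim (¬witness (x′ , ax′ , x′≁x , x′≁y))

  crossing : ∀ {k x v y} → OnlyA x → OnlyB y → x ~ v → FarWalk k v y →
    CrossA x ⊎ CrossB y ⊎ Detour x
  crossing {k} {x} {y = y} ax by x~v far with shortcut k ax by x~v far | x ~? y
  ... | _ | inj₁ x~y = map₂ inj₁ (edge-cross ax by x~y)
  ... | inj₁ x~y | inj₂ x≁y = ⊥-elim (~⇒¬≁ x~y x≁y)
  ... | inj₂ (o , far-o , x~o , o~y) | inj₂ x≁y =
        inj₂ (inj₂ (ax , o , far-o , y , by , x~o , o~y , x≁y))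

  ReachesB : V → List V → Set
  ReachesB u vs = u ≡ b ⊎ Σ V λ y → OnlyB y × y ∈ₗ vs × Σ ℕ λ k → FarWalk k u y

  HitsS : List V → Set
  HitsS = Any (_∈ S)

  extend : ∀ {u v vs} → u ~ v → ReachesB v vs → HitsS (u ∷ vs) ⊎ ReachesB u (u ∷ vs)
  extend {u} u~v reach with classify u | reach
  ... | inj₁ cu | _ = inj₁ (here (∈S⁺ (inj₁ cu)))
  ... | inj₂ (inj₂ (inj₁ bu)) | _ = inj₂ (inj₂ (u , bu , here refl , 0 , end))
  ... | inj₂ (inj₁ (_ , b≁u)) | inj₁ refl = ⊥-elim (~⇒¬≁ (~-sym u~v) b≁u)
  ... | inj₂ (inj₂ (inj₂ (_ , b≁u))) | inj₁ refl = ⊥-elim (~⇒¬≁ (~-sym u~v) b≁u)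
  ... | inj₂ (inj₂ (inj₂ far-u)) | inj₂ (y , by , y∈vs , k , far) =
        inj₂ (inj₂ (y , by , there y∈vs , suc k , link far-u u~v far))
  ... | inj₂ (inj₁ au) | inj₂ (y , by , y∈vs , k , far) with crossing au by u~v far
  ...   | inj₁ cross-u          = inj₁ (here (∈S⁺ (inj₂ (inj₁ cross-u))))
  ...   | inj₂ (inj₁ cross-y)   = inj₁ (there (lose y∈vs (∈S⁺ (inj₂ (inj₂ (inj₁ cross-y))))))
  ...   | inj₂ (inj₂ detour-u) = inj₁ (here (∈S⁺ (inj₂ (inj₂ (inj₂ detour-u)))))

  walk-to-b : ∀ {u vs} → Walk G u b vs → HitsS vs ⊎ ReachesB u vs
  walk-to-b stop = inj₂ (inj₁ refl)
  walk-to-b (step u~v walk) with walk-to-b walk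
  ... | inj₁ hit   = inj₁ (there hit)
  ... | inj₂ reach = extend u~v reach

  walk-hits-S : ∀ {vs} → Walk G a b vs → HitsS vs
  walk-hits-S walk with walk-to-b walk
  ... | inj₁ hit = hit
  ... | inj₂ (inj₁ a≡b) = ⊥-elim (a≢b a≡b)
  ... | inj₂ (inj₂ (_ , (b~a , _) , _ , _ , end)) = ⊥-elim (~⇒¬≁ b~a (≁-sym a≁b))
  ... | inj₂ (inj₂ (_ , by , _ , _ , link _ a~w far)) = ⊥-elim (~⇒¬≁ a~w (a≁FarWalk-start far by))

  separator : Separator G a b S
  separator = a∉S , b∉S , λ _ path → walk-hits-S (proj₁ path)

  CrossB-cover : ∀ {x₁ x₁′ y₁ y} → OnlyA x₁ → OnlyA x₁′ → x₁′ ≁ x₁ → x₁′ ≁ y₁ →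
    x₁ ~ y₁ → OnlyB y₁ → OnlyB y → y₁ ≁ y → x₁ ~ y ⊎ x₁′ ~ y
  CrossB-cover {x₁} {x₁′} {y₁} {y} (a~x₁ , b≁x₁) (a~x₁′ , b≁x₁′) x₁′≁x₁ x₁′≁y₁
               x₁~y₁ (b~y₁ , a≁y₁) (b~y , a≁y) y₁≁y with x₁ ~? y | x₁′ ~? y
  ... | inj₁ x₁~y | _          = inj₁ x₁~y
  ... | inj₂ _    | inj₁ x₁′~y = inj₂ x₁′~y
  ... | inj₂ x₁≁y | inj₂ x₁′≁y = ⊥-elim (noP6 (induced-P6 {x₁′} {a} {x₁} {y₁} {b} {y}
        (~-sym a~x₁′) x₁′≁x₁ x₁′≁y₁ (≁-sym b≁x₁′) x₁′≁y
        a~x₁ a≁y₁ a≁b a≁y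
        x₁~y₁ (≁-sym b≁x₁) x₁≁y
        (~-sym b~y₁) y₁≁y
        b~y))

  Detour-cover : ∀ {x₁ o₁ y₁ x} → OnlyA x₁ → Far o₁ → OnlyB y₁ → x₁ ~ o₁ → o₁ ~ y₁ →
    x₁ ≁ y₁ → OnlyA x → x ≁ x₁ → o₁ ~ x ⊎ y₁ ~ x
  Detour-cover {x₁} {o₁} {y₁} {x} (a~x₁ , b≁x₁) (a≁o₁ , b≁o₁) (b~y₁ , a≁y₁) x₁~o₁ o₁~y₁
               x₁≁y₁ (a~x , b≁x) x≁x₁ with o₁ ~? x | y₁ ~? x
  ... | inj₁ o₁~x | _         = inj₁ o₁~x
  ... | inj₂ _    | inj₁ y₁~x = inj₂ y₁~x
  ... | inj₂ o₁≁x | inj₂ y₁≁x = ⊥-elim (noP6 (induced-P6 {x} {a} {x₁} {o₁} {y₁} {b}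
        (~-sym a~x) x≁x₁ (≁-sym o₁≁x) (≁-sym y₁≁x) (≁-sym b≁x)
        a~x₁ a≁o₁ a≁y₁ a≁b
        x₁~o₁ x₁≁y₁ (≁-sym b≁x₁)
        o₁~y₁ (≁-sym b≁o₁)
        (~-sym b~y₁)))

  α-Common : αAtMost G ⟦ Common? ⟧ (t ∸ 1)
  α-Common I I⊆ I-ind = common-neighbours-bound a≢b a≁b I-ind
    (proj₁ ∘ ∈⟦⟧⁻ Common? ∘ I⊆) (proj₂ ∘ ∈⟦⟧⁻ Common? ∘ I⊆)

  α-CrossA : αAtMost G ⟦ CrossA? ⟧ (t ∸ 1)
  α-CrossA I I⊆ I-ind = ∣p∣≤k-byNonempty I λ (x₁ , x₁∈I) →
    let (_ , y₁ , by₁ , _ , dominated) = member x₁∈I in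
    common-neighbours-bound (a≢OnlyB by₁) (proj₂ by₁) I-ind
      (λ x∈I → proj₁ (proj₁ (member x∈I)))
      (λ {x} x∈I → ~-sym (dominated x (proj₁ (member x∈I)) (I-ind x x₁ x∈I x₁∈I)))
    where
    member : ∀ {x} → x ∈ I → CrossA x
    member = ∈⟦⟧⁻ CrossA? ∘ I⊆

  α-CrossB : αAtMost G ⟦ CrossB? ⟧ ((t ∸ 1) + (t ∸ 1))
  α-CrossB I I⊆ I-ind = ∣p∣≤k-byNonempty I λ (y₁ , y₁∈I) →
    let (by₁ , x₁ , ax₁ , x₁~y₁ , x₁′ , ax₁′ , x₁′≁x₁ , x₁′≁y₁) = member y₁∈I in
    two-neighbourhoods-bound (b≢OnlyA ax₁) (proj₂ ax₁) (b≢OnlyA ax₁′) (proj₂ ax₁′) I-ind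
      (λ y∈I → proj₁ (proj₁ (member y∈I)))
      (λ {y} y∈I → CrossB-cover ax₁ ax₁′ x₁′≁x₁ x₁′≁y₁ x₁~y₁ by₁ (proj₁ (member y∈I))
                                (I-ind y₁ y y₁∈I y∈I))
    where
    member : ∀ {y} → y ∈ I → CrossB y
    member = ∈⟦⟧⁻ CrossB? ∘ I⊆

  α-Detour : αAtMost G ⟦ Detour? ⟧ ((t ∸ 1) + (t ∸ 1))
  α-Detour I I⊆ I-ind = ∣p∣≤k-byNonempty I λ (x₁ , x₁∈I) →
    let (ax₁ , o₁ , far-o₁ , y₁ , by₁ , x₁~o₁ , o₁~y₁ , x₁≁y₁) = member x₁∈I in
    two-neighbourhoods-bound (≁-~⇒≢ (proj₂ by₁) o₁~y₁) (proj₁ far-o₁)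
                             (a≢OnlyB by₁) (proj₂ by₁) I-ind
      (λ x∈I → proj₁ (proj₁ (member x∈I)))
      (λ {x} x∈I → Detour-cover ax₁ far-o₁ by₁ x₁~o₁ o₁~y₁ x₁≁y₁ (proj₁ (member x∈I))
                                (I-ind x x₁ x∈I x₁∈I))
    where
    member : ∀ {x} → x ∈ I → Detour x
    member = ∈⟦⟧⁻ Detour? ∘ I⊆

  α-S : αAtMost G S (6 * (t ∸ 1))
  α-S = αAtMost-mono (≤-reflexive (six-times (t ∸ 1)))
          (αAtMost-∪ α-Common (αAtMost-∪ α-CrossA (αAtMost-∪ α-CrossB α-Detour)))
    where
    six-times : ∀ k → k + (k + ((k + k) + (k + k))) ≡ 6 * k
    six-times = solve-∀

lemma3p2 : (t : ℕ) → 2 ≤ t → (G : Graph) → P6K2tFree t G →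
    (a b : Fin (n G)) → ¬ a ≡ b → adj G a b ≡ false →
    Σ (Subset (n G)) λ S → Separator G a b S × αAtMost G S (14 * (t ∸ 1) + 3)
lemma3p2 t _ G free a b a≢b a≁b =
  S , separator , αAtMost-mono 6k≤14k+3 α-S
  where
  open Separation t G free a b a≢b a≁b
  open GraphFacts G using (αAtMost-mono)
  6k≤14k+3 : 6 * (t ∸ 1) ≤ 14 * (t ∸ 1) + 3
  6k≤14k+3 = ≤-trans (*-monoˡ-≤ (t ∸ 1) (m≤m+n 6 8)) (m≤m+n (14 * (t ∸ 1)) 3)
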